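{- For integers $k\ge 2$ and $n$ with $2k-1\le n$, $$N(BM,k,n)\le N(GM,k,n)\le (n-k+1)\cdot \mathsf{m}(k-1,n-1).$$
   Context: Majority problem: we are given $n$ balls indexed by $[n]=\{1,\dots,n\}$, each colored by one of two colors by an unknown coloring. A ball $i$ is a majority ball if more than $n/2$ balls (counting $i$) have the same color as $i$. The goal is to either identify a majority ball or correctly conclude that there is none. A query is a $k$-element subset $Q\subseteq[n]$. In the non-adaptive version, a family of queries is fixed in advance; it is successful if for every coloring the answers determine a correct output (a ball that is a majority ball for every coloring consistent with the answers, or the conclusion that no majority ball exists for every coloring consistent with the answers). In the General Model (GM), the answer to a query $Q$ is YES if $Q$ contains two balls of different colors and NO otherwise. In Borzyszkowski's Model (BM), the answer is YES together with a pointed-out pair of balls in $Q$ of different colors if such a pair exists, and NO if all balls of $Q$ have the same color. $N(GM,k,n)$ and $N(BM,k,n)$ denote the minimum number of queries in a successful non-adaptive query family in the respective model. A hypergraph has Property B if its vertices can be two-colored so that no edge is monochromatic. For $n\ge 2k-1$, $\mathsf{m}(k,n)$ denotes the minimum number of edges of a $k$-uniform hypergraph on $n$ vertices that does not have Property B. -}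

module Defs where

open import Data.Nat using (ℕ; _*_; _<_; _≤_)
open import Data.Bool using (Bool)
open import Data.Bool.Properties renaming (_≟_ to _≟ᵇ_)
open import Data.Fin using (Fin)
open import Data.Fin.Subset using (Subset; _∈_; ∣_∣)
open import Data.List using (List; length; filter)
open import Data.List.Base using ()
open import Data.Fin.Base using ()
open import Data.Maybe using (Maybe; just; nothing)
open import Data.Product using (Σ; ∃; _×_)
open import Relation.Nullary using (¬_)
open import Relation.Binary.PropositionalEquality using (_≡_; _≢_)
open import Function.Bundles using (_⇔_)
open import Function.Definitions using (Injective)
import Data.List as L
import Data.Fin as F

Coloring : ℕ → Set
Coloring n = Fin n → Bool

sameColorCount : ∀ {n} → Coloring n → Fin n → ℕ
sameColorCount {n} c i = length (filter (λ j → c j ≟ᵇ c i) (L.allFin n))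

IsMajority : ∀ {n} → Coloring n → Fin n → Set
IsMajority {n} c i = n < 2 * sameColorCount c i

Output : ℕ → Set
Output n = Maybe (Fin n)

CorrectOutput : ∀ {n} → Output n → Coloring n → Set
CorrectOutput (just i) c = IsMajority c i
CorrectOutput {n} nothing c = (i : Fin n) → ¬ IsMajority c i

Monochromatic : ∀ {n} → Coloring n → Subset n → Set
Monochromatic c Q = ∀ i j → i ∈ Q → j ∈ Q → c i ≡ c j

-- a non-adaptive family of m queries, each a k-element subset of [n]
-- (queries indexed by Fin m; the number of queries is m)
IsQueryFamily : (k n m : ℕ) → (Fin m → Subset n) → Set
IsQueryFamily k n m F = ∀ q → ∣ F q ∣ ≡ k

-- General Model: answer to Q is YES iff Q is not monochromatic.
-- Two colorings give the same answers iff they agree on monochromaticity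
-- of every query.

SuccessfulGM : (n m : ℕ) → (Fin m → Subset n) → Set
SuccessfulGM n m F =
  (c : Coloring n) → ∃ λ (out : Output n) →
    (c' : Coloring n) →
    (∀ q → Monochromatic c (F q) ⇔ Monochromatic c' (F q)) →
    CorrectOutput out c'

-- Borzyszkowski's Model: answer is NO, or YES with a pointed-out pair of
-- balls of Q of different colors (the pair is chosen by the oracle).

data BMAnswer (n : ℕ) : Set where
  no  : BMAnswer n
  yes : Fin n → Fin n → BMAnswer n

ValidBM : ∀ {n} → Coloring n → Subset n → BMAnswer n → Set
ValidBM c Q no = Monochromatic c Q
ValidBM c Q (yes i j) = i ∈ Q × j ∈ Q × c i ≢ c j

SuccessfulBM : (n m : ℕ) → (Fin m → Subset n) → Set
SuccessfulBM n m F =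
  (c : Coloring n) (a : Fin m → BMAnswer n) →
  (∀ q → ValidBM c (F q) (a q)) →
  ∃ λ (out : Output n) →
    (c' : Coloring n) →
    (∀ q → ValidBM c' (F q) (a q)) →
    CorrectOutput out c'

IsUniformHypergraph : (k n e : ℕ) → (Fin e → Subset n) → Set
IsUniformHypergraph k n e E = Injective _≡_ _≡_ E × (∀ x → ∣ E x ∣ ≡ k)

HasPropertyB : ∀ {n e} → (Fin e → Subset n) → Set
HasPropertyB {n} E = ∃ λ (c : Coloring n) → ∀ x → ¬ Monochromatic c (E x)

IsMin : (ℕ → Set) → ℕ → Set
IsMin P m = P m × (∀ m' → P m' → m ≤ m')

IsNGM : (k n : ℕ) → ℕ → Set
IsNGM k n = IsMin (λ m → Σ (Fin m → Subset n) λ F → IsQueryFamily k n m F × SuccessfulGM n m F)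

IsNBM : (k n : ℕ) → ℕ → Set
IsNBM k n = IsMin (λ m → Σ (Fin m → Subset n) λ F → IsQueryFamily k n m F × SuccessfulBM n m F)

IsMB : (k n : ℕ) → ℕ → Set
IsMB k n = IsMin (λ e → Σ (Fin e → Subset n) λ E → IsUniformHypergraph k n e E × ¬ HasPropertyB E)

-- A BM answer determines the GM answer, so every successful GM family is successful in BM.
-- For the upper bound let H be a (k-1)-uniform hypergraph without Property B with
-- m(k-1,n-1) edges on all balls but one, and ask every query e ∪ {x} with e an edge and
-- x ∉ e: these are n-k+1 queries per edge. If some query e ∪ {x₀} is monochromatic,
-- then a ball z has the colour of e iff e ∪ {z} is monochromatic, so the answers
-- determine the colour classes and hence a correct output. If no query is monochromatic,
-- some edge e is (H lacks Property B), and then the n-k+1 balls outside e, among them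
-- the extra ball, all have the other colour; this is a majority as n ≥ 2k-1.

module Submission where

open import Defs
open import Data.Nat using (ℕ; _+_; _*_; _∸_; _≤_)
open import Data.Product using (_×_)

open import Data.Nat using (zero; suc; _<_; _<?_; z≤n; s≤s; s≤s⁻¹)
open import Data.Nat.Properties
open import Data.Bool using (Bool)
open import Data.Bool.Properties using (¬-not) renaming (_≟_ to _≟ᵇ_)
open import Data.Fin using (Fin; zero; suc)
open import Data.Fin.Properties using (any?; all?)
open import Data.Fin.Subset using (Subset; inside; outside; _∈_; _∉_; _⊆_; ∣_∣; ∁; ⁅_⁆; _∪_; Nonempty)
open import Data.Fin.Subset.Properties
  using (_∈?_; drop-there; nonempty?; Empty-unique; ∣⊥∣≡0; ∣∁p∣≡n∸∣p∣; x∈∁p⇒x∉p; x∉p⇒x∈∁p; x∈⁅x⁆; x∈⁅y⁆⇒x≡y; x∈p∪q⁺; x∈p∪q⁻; ∪-identityʳ)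
open import Data.Vec using ([]; _∷_; here; there)
open import Data.List using (List; []; _∷_; length; map; filter; concatMap; allFin; tabulate; lookup)
open import Data.List.Properties using (length-map; length-++; length-tabulate; filter-≐)
open import Data.List.Membership.Propositional using () renaming (_∈_ to _∈ˡ_)
open import Data.List.Membership.Propositional.Properties using (∈-map⁺; ∈-map⁻; ∈-concat⁺′; ∈-concatMap⁻; ∈-allFin; ∈-lookup)
open import Data.List.Relation.Unary.Any as Any using (index; satisfied)
open import Data.List.Relation.Unary.Any.Properties using (lookup-index)
open import Data.Maybe using (just; nothing)
open import Data.Product using (∃; ∃₂; _,_)
open import Data.Sum using ([_,_]′; inj₁; inj₂)
open import Function using (_∘_; id)
open import Function.Bundles using (_⇔_; mk⇔; Equivalence)
open import Function.Properties.Equivalence using () renaming (sym to ⇔-sym; trans to ⇔-trans)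
open import Relation.Nullary using (¬_; contradiction; _→-dec_)
import Relation.Nullary as Dec
open import Relation.Unary using (Pred; Decidable)
open import Relation.Binary.PropositionalEquality using (_≡_; _≢_; refl; sym; trans; cong; cong₂; subst; module ≡-Reasoning)

open Equivalence using (to; from)

successfulGM⇒successfulBM : ∀ {n m} {F : Fin m → Subset n} → SuccessfulGM n m F → SuccessfulBM n m F
successfulGM⇒successfulBM {F = F} gm c a valid with out , correct ← gm c =
  out , λ c' valid' → correct c' (λ q → sameMonochromaticity (F q) (a q) (valid q) (valid' q))
  where
  sameMonochromaticity : ∀ {c c'} Q a → ValidBM c Q a → ValidBM c' Q a →
    Monochromatic c Q ⇔ Monochromatic c' Q
  sameMonochromaticity Q no        mono mono' = mk⇔ (λ _ → mono') (λ _ → mono)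
  sameMonochromaticity Q (yes i j) (i∈ , j∈ , ci≢cj) (i∈' , j∈' , c'i≢c'j) =
    mk⇔ (λ mono → contradiction (mono i j i∈ j∈) ci≢cj) (λ mono' → contradiction (mono' i j i∈' j∈') c'i≢c'j)

≢-≢⇒≡ : ∀ {a b p : Bool} → a ≢ p → b ≢ p → a ≡ b
≢-≢⇒≡ a≢p b≢p = trans (¬-not a≢p) (sym (¬-not b≢p))

≡-resp-⇔ : ∀ {a b p a' b' p' : Bool} → (a ≡ p ⇔ a' ≡ p') → (b ≡ p ⇔ b' ≡ p') → a ≡ b → a' ≡ b'
≡-resp-⇔ {a} {p = p} a⇔a' b⇔b' refl with a ≟ᵇ p
... | Dec.yes a≡p = trans (to a⇔a' a≡p) (sym (to b⇔b' a≡p))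
... | Dec.no a≢p  = ≢-≢⇒≡ (a≢p ∘ from a⇔a') (a≢p ∘ from b⇔b')

SameClasses : ∀ {n} → Coloring n → Coloring n → Set
SameClasses {n} c c' = ∀ (i j : Fin n) → c i ≡ c j ⇔ c' i ≡ c' j

sameClasses-via-pivot : ∀ {n} {c c' : Coloring n} w → (∀ z → c z ≡ c w ⇔ c' z ≡ c' w) → SameClasses c c'
sameClasses-via-pivot w same i j =
  mk⇔ (≡-resp-⇔ (same i) (same j)) (≡-resp-⇔ (⇔-sym (same i)) (⇔-sym (same j)))

sameColorCount-cong : ∀ {n} {c c' : Coloring n} → SameClasses c c' → ∀ i → sameColorCount c i ≡ sameColorCount c' i
sameColorCount-cong {n} {c} {c'} same i =
  cong length (filter-≐ (λ j → c j ≟ᵇ c i) (λ j → c' j ≟ᵇ c' i) (to (same _ i) , from (same _ i)) (allFin n))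

correctOutput-cong : ∀ {n} {c c' : Coloring n} → SameClasses c c' → ∀ out → CorrectOutput out c → CorrectOutput out c'
correctOutput-cong same (just i) maj rewrite sameColorCount-cong same i = maj
correctOutput-cong same nothing none i maj rewrite sym (sameColorCount-cong same i) = none i maj

correctOutput : ∀ {n} (c : Coloring n) → ∃ λ out → CorrectOutput out c
correctOutput {n} c with any? (λ i → n <? 2 * sameColorCount c i)
... | Dec.yes (i , maj) = just i , maj
... | Dec.no none       = nothing , λ i maj → none (i , maj)

module _ {a p} {A : Set a} {P : Pred A p} (P? : Decidable P) where

  n≤length[filter]+∣E∣ : ∀ {n} (E : Subset n) (f : Fin n → A) → (∀ j → j ∉ E → P (f j)) →
    n ≤ length (filter P? (tabulate f)) + ∣ E ∣
  n≤length[filter]+∣E∣ [] f outside-P = z≤n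
  n≤length[filter]+∣E∣ (s ∷ E) f outside-P
    with ih ← n≤length[filter]+∣E∣ E (f ∘ suc) (λ j j∉E → outside-P (suc j) (j∉E ∘ drop-there))
       | P? (f zero) | s
  ... | Dec.yes _  | outside = s≤s ih
  ... | Dec.yes _  | inside  = s≤s (≤-trans ih (+-monoʳ-≤ _ (n≤1+n _)))
  ... | Dec.no ¬P0 | outside = contradiction (outside-P zero λ ()) ¬P0
  ... | Dec.no _   | inside  = ≤-trans (s≤s ih) (≤-reflexive (sym (+-suc _ _)))

n≤sameColorCount+∣E∣ : ∀ {n} (c : Coloring n) i (E : Subset n) → (∀ j → j ∉ E → c j ≡ c i) →
  n ≤ sameColorCount c i + ∣ E ∣
n≤sameColorCount+∣E∣ c i E = n≤length[filter]+∣E∣ (λ j → c j ≟ᵇ c i) E id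

m≤n+o⇒o+o<m⇒m<2*n : ∀ {m n o} → m ≤ n + o → o + o < m → m < 2 * n
m≤n+o⇒o+o<m⇒m<2*n {m} {n} {o} m≤n+o 2o<m = begin-strict
  m      ≤⟨ m≤n+o ⟩
  n + o  <⟨ +-monoʳ-< n o<n ⟩
  n + n  ≡⟨ cong (n +_) (sym (+-identityʳ n)) ⟩
  2 * n  ∎
  where
  open ≤-Reasoning
  o<n : o < n
  o<n = +-cancelʳ-< o o n (<-≤-trans 2o<m m≤n+o)

monochromatic? : ∀ {n} (c : Coloring n) → Decidable (Monochromatic c)
monochromatic? c Q = all? λ i → all? λ j → i ∈? Q →-dec (j ∈? Q →-dec c i ≟ᵇ c j)

monochromatic-⊆ : ∀ {n} {c : Coloring n} {P Q} → P ⊆ Q → Monochromatic c Q → Monochromatic c P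
monochromatic-⊆ P⊆Q mono i j i∈P j∈P = mono i j (P⊆Q i∈P) (P⊆Q j∈P)

monochromatic-outside∷ : ∀ {n} {c : Coloring (suc n)} {E} → Monochromatic (c ∘ suc) E → Monochromatic c (outside ∷ E)
monochromatic-outside∷ mono (suc i) (suc j) (there i∈E) (there j∈E) = mono i j i∈E j∈E

monochromatic-∪⁅⁆⇔ : ∀ {n} {c : Coloring n} {E w z} → Monochromatic c E → w ∈ E →
  Monochromatic c (E ∪ ⁅ z ⁆) ⇔ c z ≡ c w
monochromatic-∪⁅⁆⇔ {c = c} {E} {w} {z} mono w∈E = mk⇔
  (λ mono′ → mono′ z w (x∈p∪q⁺ (inj₂ (x∈⁅x⁆ z))) (x∈p∪q⁺ (inj₁ w∈E)))
  (λ cz≡cw i j i∈ j∈ → trans (colour i i∈ cz≡cw) (sym (colour j j∈ cz≡cw)))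
  where
  colour : ∀ i → i ∈ E ∪ ⁅ z ⁆ → c z ≡ c w → c i ≡ c w
  colour i i∈ cz≡cw = [ (λ i∈E → mono i w i∈E w∈E) , (λ i∈⁅z⁆ → trans (cong c (x∈⁅y⁆⇒x≡y z i∈⁅z⁆)) cz≡cw) ]′
    (x∈p∪q⁻ E ⁅ z ⁆ i∈)

∣p∪⁅x⁆∣≡1+∣p∣ : ∀ {n} {p : Subset n} {x} → x ∉ p → ∣ p ∪ ⁅ x ⁆ ∣ ≡ suc ∣ p ∣
∣p∪⁅x⁆∣≡1+∣p∣ {p = outside ∷ p} {zero}  _   = cong (suc ∘ ∣_∣) (∪-identityʳ p)
∣p∪⁅x⁆∣≡1+∣p∣ {p = inside ∷ p}  {zero}  x∉p = contradiction here x∉p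
∣p∪⁅x⁆∣≡1+∣p∣ {p = outside ∷ p} {suc x} x∉p = ∣p∪⁅x⁆∣≡1+∣p∣ (x∉p ∘ there)
∣p∪⁅x⁆∣≡1+∣p∣ {p = inside ∷ p}  {suc x} x∉p = cong suc (∣p∪⁅x⁆∣≡1+∣p∣ (x∉p ∘ there))

∣p∣≡1+k⇒Nonempty : ∀ {n k} {p : Subset n} → ∣ p ∣ ≡ suc k → Nonempty p
∣p∣≡1+k⇒Nonempty {n} {p = p} ∣p∣≡1+k with nonempty? p
... | Dec.yes ne = ne
... | Dec.no empty with () ← trans (sym (trans (cong ∣_∣ (Empty-unique empty)) (∣⊥∣≡0 n))) ∣p∣≡1+k

¬propertyB⇒monochromaticEdge : ∀ {n e} {E : Fin e → Subset n} → ¬ HasPropertyB E →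
  (c : Coloring n) → ∃ λ x → Monochromatic c (E x)
¬propertyB⇒monochromaticEdge {E = E} ¬B c with any? (λ x → monochromatic? c (E x))
... | Dec.yes mono = mono
... | Dec.no none  = contradiction (c , λ x mono → none (x , mono)) ¬B

elements : ∀ {n} → Subset n → List (Fin n)
elements []            = []
elements (inside ∷ p)  = zero ∷ map suc (elements p)
elements (outside ∷ p) = map suc (elements p)

length-elements : ∀ {n} (p : Subset n) → length (elements p) ≡ ∣ p ∣
length-elements []            = refl
length-elements (inside ∷ p)  = cong suc (trans (length-map suc (elements p)) (length-elements p))
length-elements (outside ∷ p) = trans (length-map suc (elements p)) (length-elements p)

∈-elements⁺ : ∀ {n} {p : Subset n} {x} → x ∈ p → x ∈ˡ elements p
∈-elements⁺ here = Any.here refl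
∈-elements⁺ {p = inside ∷ p}  (there x∈p) = Any.there (∈-map⁺ suc (∈-elements⁺ x∈p))
∈-elements⁺ {p = outside ∷ p} (there x∈p) = ∈-map⁺ suc (∈-elements⁺ x∈p)

∈-elements⁻ : ∀ {n} {p : Subset n} {x} → x ∈ˡ elements p → x ∈ p
∈-elements⁻ {p = inside ∷ p} (Any.here refl) = here
∈-elements⁻ {p = inside ∷ p} (Any.there x∈) with _ , y∈ , refl ← ∈-map⁻ suc x∈ = there (∈-elements⁻ y∈)
∈-elements⁻ {p = outside ∷ p} x∈ with _ , y∈ , refl ← ∈-map⁻ suc x∈ = there (∈-elements⁻ y∈)

length-concatMap-const : ∀ {a b} {A : Set a} {B : Set b} {f : A → List B} {m} → (∀ x → length (f x) ≡ m) →
  ∀ xs → length (concatMap f xs) ≡ length xs * m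
length-concatMap-const ∣f∣≡m []       = refl
length-concatMap-const {f = f} ∣f∣≡m (x ∷ xs) =
  trans (length-++ (f x)) (cong₂ _+_ (∣f∣≡m x) (length-concatMap-const ∣f∣≡m xs))

module EdgeExtensions {n r} (H : Fin r → Subset n) where

  -- H lives on the balls suc _, so ball zero lies in no edge.
  edge : Fin r → Subset (suc n)
  edge q = outside ∷ H q

  extensions : Fin r → List (Subset (suc n))
  extensions q = map (λ x → edge q ∪ ⁅ x ⁆) (elements (∁ (edge q)))

  queries : List (Subset (suc n))
  queries = concatMap extensions (allFin r)

  query : Fin (length queries) → Subset (suc n)
  query = lookup queries

  query-shape : ∀ i → ∃₂ λ q x → x ∉ edge q × query i ≡ edge q ∪ ⁅ x ⁆
  query-shape i with q , Qi∈ ← satisfied (∈-concatMap⁻ extensions {xs = allFin r} (∈-lookup i))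
    with x , x∈ , Qi≡ ← ∈-map⁻ _ Qi∈ = q , x , x∈∁p⇒x∉p (∈-elements⁻ x∈) , Qi≡

  query-complete : ∀ q x → x ∉ edge q → ∃ λ i → query i ≡ edge q ∪ ⁅ x ⁆
  query-complete q x x∉ = index Q∈ , sym (lookup-index Q∈)
    where
    Q∈ : edge q ∪ ⁅ x ⁆ ∈ˡ queries
    Q∈ = ∈-concat⁺′ (∈-map⁺ _ (∈-elements⁺ (x∉p⇒x∈∁p x∉))) (∈-map⁺ extensions (∈-allFin q))

  module _ {k} (∣H∣≡k : ∀ q → ∣ H q ∣ ≡ k) where

    query-size : IsQueryFamily (suc k) (suc n) (length queries) query
    query-size i with q , x , x∉ , Qi≡ ← query-shape i =
      trans (cong ∣_∣ Qi≡) (trans (∣p∪⁅x⁆∣≡1+∣p∣ x∉) (cong suc (∣H∣≡k q)))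

    length-queries : length queries ≡ r * (suc n ∸ k)
    length-queries =
      trans (length-concatMap-const length-extensions (allFin r)) (cong (_* (suc n ∸ k)) (length-tabulate {n = r} id))
      where
      length-extensions : ∀ q → length (extensions q) ≡ suc n ∸ k
      length-extensions q = begin
        length (extensions q)           ≡⟨ length-map _ (elements (∁ (edge q))) ⟩
        length (elements (∁ (edge q)))  ≡⟨ length-elements (∁ (edge q)) ⟩
        ∣ ∁ (edge q) ∣                  ≡⟨ ∣∁p∣≡n∸∣p∣ (edge q) ⟩
        suc n ∸ ∣ H q ∣                 ≡⟨ cong (suc n ∸_) (∣H∣≡k q) ⟩
        suc n ∸ k                       ∎
        where open ≡-Reasoning

module _ {n r k} {H : Fin r → Subset n} (∣H∣≡1+k : ∀ q → ∣ H q ∣ ≡ suc k) (¬B : ¬ HasPropertyB H)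
         (2k+2<1+n : suc k + suc k < suc n) where

  open EdgeExtensions H

  edge-nonempty : ∀ q → Nonempty (edge q)
  edge-nonempty q with w , w∈ ← ∣p∣≡1+k⇒Nonempty (∣H∣≡1+k q) = suc w , there w∈

  zero-isMajority : (c : Coloring (suc n)) → (∀ i → ¬ Monochromatic c (query i)) → IsMajority c zero
  zero-isMajority c none
    with q , mono ← ¬propertyB⇒monochromaticEdge ¬B (c ∘ suc)
    with w , w∈ ← edge-nonempty q =
    m≤n+o⇒o+o<m⇒m<2*n {n = sameColorCount c zero} {o = suc k}
      (subst (λ e → suc n ≤ sameColorCount c zero + e) (∣H∣≡1+k q) (n≤sameColorCount+∣E∣ c zero (edge q) outsiders-agree))
      2k+2<1+n
    where
    outsider-colour : ∀ x → x ∉ edge q → c x ≢ c w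
    outsider-colour x x∉ cx≡cw with i , Qi≡ ← query-complete q x x∉ =
      none i (subst (Monochromatic c) (sym Qi≡)
                    (from (monochromatic-∪⁅⁆⇔ (monochromatic-outside∷ mono) w∈) cx≡cw))
    outsiders-agree : ∀ x → x ∉ edge q → c x ≡ c zero
    outsiders-agree x x∉ = ≢-≢⇒≡ (outsider-colour x x∉) (outsider-colour zero λ ())

  sameClasses-of-monochromaticQuery : (c c' : Coloring (suc n)) →
    (∀ i → Monochromatic c (query i) ⇔ Monochromatic c' (query i)) →
    ∀ i → Monochromatic c (query i) → SameClasses c c'
  sameClasses-of-monochromaticQuery c c' consistent i₀ mono₀
    with q , _ , _ , Qi₀≡ ← query-shape i₀
    with w , w∈ ← edge-nonempty q =
    sameClasses-via-pivot w sameColour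
    where
    edge-mono : ∀ {c} → Monochromatic c (query i₀) → Monochromatic c (edge q)
    edge-mono mono = monochromatic-⊆ (x∈p∪q⁺ ∘ inj₁) (subst (Monochromatic _) Qi₀≡ mono)
    mono-c : Monochromatic c (edge q)
    mono-c = edge-mono mono₀
    mono-c' : Monochromatic c' (edge q)
    mono-c' = edge-mono (to (consistent i₀) mono₀)
    sameColour : ∀ z → c z ≡ c w ⇔ c' z ≡ c' w
    sameColour z with z ∈? edge q
    ... | Dec.yes z∈ = mk⇔ (λ _ → mono-c' z w z∈ w∈) (λ _ → mono-c z w z∈ w∈)
    ... | Dec.no z∉ with i , Qi≡ ← query-complete q z z∉ =
      ⇔-trans (⇔-sym (monochromatic-∪⁅⁆⇔ mono-c w∈))
        (⇔-trans (subst (λ Q → Monochromatic c Q ⇔ Monochromatic c' Q) Qi≡ (consistent i))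
                 (monochromatic-∪⁅⁆⇔ mono-c' w∈))

  extensions-successful : SuccessfulGM (suc n) (length queries) query
  extensions-successful c with any? (λ i → monochromatic? c (query i))
  ... | Dec.no none =
    just zero , λ c' consistent → zero-isMajority c' (λ i → none ∘ (i ,_) ∘ from (consistent i))
  ... | Dec.yes (i , mono) with out , correct ← correctOutput c =
    out , λ c' consistent → correctOutput-cong (sameClasses-of-monochromaticQuery c c' consistent i mono) out correct

theorem9 : (k n : ℕ) → 2 ≤ k → 2 * k ∸ 1 ≤ n →
    (nBM nGM mB : ℕ) → IsNBM k n nBM → IsNGM k n nGM → IsMB (k ∸ 1) (n ∸ 1) mB →
    nBM ≤ nGM × nGM ≤ (n ∸ k + 1) * mB
theorem9 (suc zero) _ (s≤s ()) _ _ _ _ _ _ _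
theorem9 (suc (suc k)) zero _ () _ _ _ _ _ _
theorem9 (suc (suc k)) (suc n) _ 2k+3≤1+n nBM nGM mB
         (_ , nBM-minimal) ((F , F-size , F-successful) , nGM-minimal) ((H , (_ , ∣H∣≡1+k) , ¬B) , _) =
  nBM-minimal nGM (F , F-size , successfulGM⇒successfulBM F-successful) ,
  (begin
    nGM                     ≤⟨ nGM-minimal _ (query , query-size ∣H∣≡1+k , successful) ⟩
    length queries          ≡⟨ length-queries ∣H∣≡1+k ⟩
    mB * (n ∸ k)            ≡⟨ cong (mB *_) (+-∸-assoc 1 1+k≤n) ⟩
    mB * (1 + (n ∸ suc k))  ≡⟨ *-comm mB _ ⟩
    (1 + (n ∸ suc k)) * mB  ≡⟨ cong (_* mB) (+-comm 1 (n ∸ suc k)) ⟩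
    (n ∸ suc k + 1) * mB    ∎)
  where
  open EdgeExtensions H
  open ≤-Reasoning
  2k+2<1+n : suc k + suc k < suc n
  2k+2<1+n = subst (_≤ suc n) (cong suc (trans (+-suc k _) (cong (λ m → suc (k + suc m)) (+-identityʳ k)))) 2k+3≤1+n
  1+k≤n : suc k ≤ n
  1+k≤n = ≤-trans (m≤m+n (suc k) (suc k)) (s≤s⁻¹ 2k+2<1+n)
  successful : SuccessfulGM (suc n) (length queries) query
  successful = extensions-successful ∣H∣≡1+k ¬B 2k+2<1+n
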